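{- Let $k$ be odd with $k\ge 5$ and let $n>k$ be a positive integer with $n\equiv (k+1)/2 \pmod{k}$. Then $\mathrm{msum}(n,k)>1$.
   Context: $S_n$ denotes the set of permutations $\pi=(\pi_1,\ldots,\pi_n)$ of $1,\ldots,n$, with indices taken cyclically: $\pi_{n+i}=\pi_i$. For $\pi\in S_n$ let $s_i=\sum_{j=0}^{k-1}\pi_{i+j}$ for $i=1,\ldots,n$. Define $\mathrm{msum}(\pi,k)=\max\{s_i: 1\le i\le n\}-\frac{k(n+1)}{2}$ and $\mathrm{msum}(n,k)=\min\{\mathrm{msum}(\pi,k):\pi\in S_n\}$. -}

module Defs where

open import Data.Nat using (ℕ; zero; suc; _+_; _*_; _⊔_; NonZero)
open import Data.Nat.DivMod using (_%_; m%n<n)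
open import Data.Fin using (Fin; toℕ; fromℕ<)
open import Data.Fin.Permutation using (Permutation′; _⟨$⟩ʳ_)
open import Data.List using (List; map; foldr; allFin; upTo)
open import Data.Nat.ListAction using (sum)
open import Data.Integer using (+_)
open import Data.Rational using (ℚ; _/_; _-_)

-- A permutation π = (π_1,…,π_n) of 1,…,n is represented by a bijection
-- σ : Fin n ↔ Fin n, with π_{i+1} = toℕ (σ i) + 1 (0-based positions).

-- value at (0-based) position p, taken cyclically: π_{p+1} with p read mod n
val : ∀ {n} .{{_ : NonZero n}} → Permutation′ n → ℕ → ℕ
val {n} σ p = suc (toℕ (σ ⟨$⟩ʳ fromℕ< (m%n<n p n)))

-- s_{i+1} = Σ_{j=0}^{k-1} π_{i+1+j}   (i 0-based)
windowSum : ∀ {n} .{{_ : NonZero n}} → Permutation′ n → ℕ → Fin n → ℕ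
windowSum σ k i = sum (map (λ j → val σ (toℕ i + j)) (upTo k))

maxWindowSum : ∀ {n} .{{_ : NonZero n}} → Permutation′ n → ℕ → ℕ
maxWindowSum {n} σ k = foldr _⊔_ 0 (map (windowSum σ k) (allFin n))

msumπ : ∀ {n} .{{_ : NonZero n}} → Permutation′ n → ℕ → ℚ
msumπ {n} σ k = ((+ maxWindowSum σ k) / 1) - ((+ (k * (n + 1))) / 2)

module Submission where

-- Write k = 2h+1 and n = qk + h + 1 (q ≥ 1).  Then 2n = Kk + 1 with
-- K = 2q+1.  Walk twice around the cycle, starting at the position of the
-- entry 1: these 2n entries sum to 2·(1+⋯+n) = n(n+1); after the leading 1
-- the remaining Kk entries split into K windows of length k, each of sum at
-- most M = max_i s_i.  Hence n(n+1) ≤ 1 + K·M, and since n > 2K+1 a short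
-- computation gives 2M ≥ k(n+1) + 3, i.e. msum(π,k) = M − k(n+1)/2 > 1.

open import Defs
open import Data.Nat
  using (ℕ; zero; suc; _+_; _*_; _∸_; _⊔_; _≤_; _<_; z≤n; s≤s; NonZero)
open import Data.Nat.Properties
open import Data.Nat.DivMod
  using (_%_; _/_; m%n<n; m≡m%n+[m/n]*n; [m+n]%n≡m%n; m<n⇒m%n≡m; m*n/n≡m; %-distribˡ-+; m%n%n≡m%n)
open import Data.Nat.ListAction using (sum)
open import Data.Nat.Tactic.RingSolver using (solve-∀)
open import Data.Fin using (Fin; toℕ; fromℕ<) renaming (zero to 0F)
open import Data.Fin.Properties using (fromℕ<-cong; fromℕ<-toℕ; toℕ-fromℕ<; toℕ<n)
open import Data.Fin.Permutation using (Permutation′; _⟨$⟩ʳ_; _⟨$⟩ˡ_; inverseʳ)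
open import Data.List using (_∷_; map; foldr; applyUpTo; allFin)
open import Data.List.Membership.Propositional using (_∈_)
open import Data.List.Membership.Propositional.Properties using (∈-allFin)
open import Data.List.Relation.Unary.Any using (here; there)
open import Data.Product using (_×_; _,_)
open import Data.Empty using (⊥-elim)
import Algebra.Properties.CommutativeMonoid.Sum as CommutativeMonoidSum
import Data.Integer as ℤ
import Data.Integer.Properties as ℤP
import Data.Integer.Tactic.RingSolver as ℤSolver
import Data.Rational.Unnormalised as ℚᵘ
import Data.Rational.Unnormalised.Properties as ℚᵘP
open import Data.Rational as ℚ using (1ℚ; toℚᵘ) renaming (_<_ to _<ℚ_)
import Data.Rational.Properties as ℚP
open import Relation.Binary.PropositionalEquality
  using (_≡_; refl; sym; trans; cong; cong₂; subst; module ≡-Reasoning)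

sumTo : (ℕ → ℕ) → ℕ → ℕ
sumTo F zero    = 0
sumTo F (suc L) = F 0 + sumTo (λ m → F (suc m)) L

sumTo-cong : ∀ {F G} L → (∀ m → F m ≡ G m) → sumTo F L ≡ sumTo G L
sumTo-cong zero    F≗G = refl
sumTo-cong (suc L) F≗G = cong₂ _+_ (F≗G 0) (sumTo-cong L (λ m → F≗G (suc m)))

sumTo-split : ∀ F a b → sumTo F (a + b) ≡ sumTo F a + sumTo (λ m → F (a + m)) b
sumTo-split F zero    b = refl
sumTo-split F (suc a) b =
  trans (cong (F 0 +_) (sumTo-split (λ m → F (suc m)) a b)) (sym (+-assoc (F 0) _ _))

sumTo-last : ∀ F L → sumTo F (suc L) ≡ sumTo F L + F L
sumTo-last F L = begin
  sumTo F (suc L)          ≡⟨ cong (sumTo F) (+-comm 1 L) ⟩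
  sumTo F (L + 1)          ≡⟨ sumTo-split F L 1 ⟩
  sumTo F L + (F (L + 0) + 0) ≡⟨ cong (sumTo F L +_) (trans (+-identityʳ _) (cong F (+-identityʳ L))) ⟩
  sumTo F L + F L          ∎
  where open ≡-Reasoning

sum-applyUpTo : ∀ (g h : ℕ → ℕ) L → sum (map g (applyUpTo h L)) ≡ sumTo (λ m → g (h m)) L
sum-applyUpTo g h zero    = refl
sum-applyUpTo g h (suc L) = cong (g (h 0) +_) (sum-applyUpTo g (λ m → h (suc m)) L)

sumTo-gauss : ∀ L → 2 * sumTo suc L ≡ L * suc L
sumTo-gauss zero    = refl
sumTo-gauss (suc L) = begin
  2 * sumTo suc (suc L)         ≡⟨ cong (2 *_) (sumTo-last suc L) ⟩
  2 * (sumTo suc L + suc L)     ≡⟨ *-distribˡ-+ 2 (sumTo suc L) (suc L) ⟩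
  2 * sumTo suc L + 2 * suc L   ≡⟨ cong (_+ 2 * suc L) (sumTo-gauss L) ⟩
  L * suc L + 2 * suc L         ≡⟨ factor L ⟩
  suc L * suc (suc L)           ∎
  where
  open ≡-Reasoning
  factor : ∀ L → L * suc L + 2 * suc L ≡ suc L * suc (suc L)
  factor = solve-∀

sumTo-blocks : ∀ k M F K → (∀ t → sumTo (λ j → F (t * k + j)) k ≤ M) → sumTo F (K * k) ≤ K * M
sumTo-blocks k M F zero    block≤M = z≤n
sumTo-blocks k M F (suc K) block≤M = begin
  sumTo F (k + K * k)                               ≡⟨ sumTo-split F k (K * k) ⟩
  sumTo F k + sumTo (λ m → F (k + m)) (K * k)       ≤⟨ +-mono-≤ (block≤M 0) (sumTo-blocks k M _ K later≤M) ⟩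
  M + K * M                                         ∎
  where
  open ≤-Reasoning
  later≤M : ∀ t → sumTo (λ j → F (k + (t * k + j))) k ≤ M
  later≤M t = ≤-trans (≤-reflexive (sumTo-cong k (λ j → cong F (sym (+-assoc k (t * k) j))))) (block≤M (suc t))

module FinSum = CommutativeMonoidSum +-0-commutativeMonoid

sumTo-finSum : ∀ L F → sumTo F L ≡ FinSum.sum {L} (λ i → F (toℕ i))
sumTo-finSum zero    F = refl
sumTo-finSum (suc L) F = cong (F 0 +_) (sumTo-finSum L (λ m → F (suc m)))

sumTo-permute : ∀ {L} F (τ : Permutation′ L) → FinSum.sum {L} (λ i → F (toℕ (τ ⟨$⟩ʳ i))) ≡ sumTo F L
sumTo-permute {L} F τ = trans (sym (FinSum.sum-permute (λ i → F (toℕ i)) τ)) (sym (sumTo-finSum L F))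

Periodic : ℕ → (ℕ → ℕ) → Set
Periodic N f = ∀ x → f (x + N) ≡ f x

module _ {N : ℕ} {f : ℕ → ℕ} (f-periodic : Periodic N f) where

  -- shifting a window of length N by one step does not change its sum:
  -- the term f p leaving at the front re-enters at the back as f (p + N)
  periodic-shift : ∀ p → sumTo (λ m → f (suc p + m)) N ≡ sumTo (λ m → f (p + m)) N
  periodic-shift p = +-cancelˡ-≡ (f p) _ _ (begin
    f p + sumTo (λ m → f (suc p + m)) N       ≡⟨ cong₂ _+_ (cong f (+-identityʳ p)) (sumTo-cong N (λ m → cong f (+-suc p m))) ⟨
    sumTo (λ m → f (p + m)) (suc N)           ≡⟨ sumTo-last _ N ⟩
    sumTo (λ m → f (p + m)) N + f (p + N)     ≡⟨ cong (sumTo (λ m → f (p + m)) N +_) (f-periodic p) ⟩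
    sumTo (λ m → f (p + m)) N + f p           ≡⟨ +-comm _ (f p) ⟩
    f p + sumTo (λ m → f (p + m)) N           ∎)
    where open ≡-Reasoning

  periodic-window : ∀ p → sumTo (λ m → f (p + m)) N ≡ sumTo f N
  periodic-window zero    = refl
  periodic-window (suc p) = trans (periodic-shift p) (periodic-window p)

  periodic-twoPeriods : ∀ p → sumTo (λ m → f (p + m)) (N + N) ≡ 2 * sumTo f N
  periodic-twoPeriods p = begin
    sumTo (λ m → f (p + m)) (N + N)                                ≡⟨ sumTo-split _ N N ⟩
    sumTo (λ m → f (p + m)) N + sumTo (λ m → f (p + (N + m))) N    ≡⟨ cong (sumTo _ N +_) (sumTo-cong N secondPeriod) ⟩
    sumTo (λ m → f (p + m)) N + sumTo (λ m → f (p + m)) N          ≡⟨ cong₂ _+_ (periodic-window p) (periodic-window p) ⟩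
    sumTo f N + sumTo f N                                          ≡⟨ cong (sumTo f N +_) (+-identityʳ _) ⟨
    2 * sumTo f N                                                  ∎
    where
    open ≡-Reasoning
    secondPeriod : ∀ m → f (p + (N + m)) ≡ f (p + m)
    secondPeriod m = trans (cong f (trans (cong (p +_) (+-comm N m)) (sym (+-assoc p m N)))) (f-periodic (p + m))

[m%n+j]%n≡[m+j]%n : ∀ m j n .{{_ : NonZero n}} → (m % n + j) % n ≡ (m + j) % n
[m%n+j]%n≡[m+j]%n m j n = begin
  (m % n + j) % n            ≡⟨ %-distribˡ-+ (m % n) j n ⟩
  (m % n % n + j % n) % n    ≡⟨ cong (λ x → (x + j % n) % n) (m%n%n≡m%n m n) ⟩
  (m % n + j % n) % n        ≡⟨ %-distribˡ-+ m j n ⟨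
  (m + j) % n                ∎
  where open ≡-Reasoning

≤-maximum : ∀ {A : Set} (g : A → ℕ) {x} xs → x ∈ xs → g x ≤ foldr _⊔_ 0 (map g xs)
≤-maximum g (y ∷ ys) (here refl) = m≤m⊔n (g y) _
≤-maximum g (y ∷ ys) (there x∈ys) = m≤n⇒m≤o⊔n (g y) (≤-maximum g ys x∈ys)

module CyclicSequence (n′ : ℕ) (σ : Permutation′ (suc n′)) where

  N : ℕ
  N = suc n′

  val-mod : ∀ x y → x % N ≡ y % N → val σ x ≡ val σ y
  val-mod x y x≡y = cong (λ i → suc (toℕ (σ ⟨$⟩ʳ i))) (fromℕ<-cong _ _ x≡y (m%n<n x N) (m%n<n y N))

  val-periodic : Periodic N (val σ)
  val-periodic x = val-mod (x + N) x ([m+n]%n≡m%n x N)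

  val-position : ∀ (i : Fin N) → val σ (toℕ i) ≡ suc (toℕ (σ ⟨$⟩ʳ i))
  val-position i = cong (λ j → suc (toℕ (σ ⟨$⟩ʳ j)))
    (trans (fromℕ<-cong _ _ (m<n⇒m%n≡m (toℕ<n i)) (m%n<n (toℕ i) N) (toℕ<n i)) (fromℕ<-toℕ i (toℕ<n i)))

  pos₁ : ℕ
  pos₁ = toℕ (σ ⟨$⟩ˡ 0F)

  val-pos₁ : val σ pos₁ ≡ 1
  val-pos₁ = trans (val-position (σ ⟨$⟩ˡ _)) (cong (λ i → suc (toℕ i)) (inverseʳ σ))

  -- one period holds the values 1,…,N, so twice its sum is N(N+1)
  twice-periodSum : 2 * sumTo (val σ) N ≡ N * suc N
  twice-periodSum = begin
    2 * sumTo (val σ) N                           ≡⟨ cong (2 *_) (sumTo-finSum N (val σ)) ⟩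
    2 * FinSum.sum {N} (λ i → val σ (toℕ i))      ≡⟨ cong (2 *_) (FinSum.sum-cong-≗ {N} val-position) ⟩
    2 * FinSum.sum {N} (λ i → suc (toℕ (σ ⟨$⟩ʳ i))) ≡⟨ cong (2 *_) (sumTo-permute suc σ) ⟩
    2 * sumTo suc N                               ≡⟨ sumTo-gauss N ⟩
    N * suc N                                     ∎
    where open ≡-Reasoning

  -- every cyclic window of length k starting anywhere is one of the s_i
  window≤max : ∀ k a → sumTo (λ j → val σ (a + j)) k ≤ maxWindowSum σ k
  window≤max k a = ≤-trans (≤-reflexive window≡s) (≤-maximum (windowSum σ k) (allFin N) (∈-allFin i))
    where
    i : Fin N
    i = fromℕ< (m%n<n a N)
    sameResidue : ∀ j → (toℕ i + j) % N ≡ (a + j) % N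
    sameResidue j = trans (cong (λ x → (x + j) % N) (toℕ-fromℕ< (m%n<n a N))) ([m%n+j]%n≡[m+j]%n a j N)
    window≡s : sumTo (λ j → val σ (a + j)) k ≡ windowSum σ k i
    window≡s = sym (trans (sum-applyUpTo (λ j → val σ (toℕ i + j)) (λ m → m) k)
                          (sumTo-cong k (λ j → val-mod (toℕ i + j) (a + j) (sameResidue j))))

  -- the counting inequality: if 2N = Kk + 1 then N(N+1) ≤ 1 + K·max_i s_i.
  -- Two rounds starting at the entry 1 give the 1 followed by K windows.
  counting : ∀ k K → K * k + 1 ≡ N + N → N * suc N ≤ 1 + K * maxWindowSum σ k
  counting k K Kk+1≡2N = begin
    N * suc N                                       ≡⟨ twice-periodSum ⟨
    2 * sumTo (val σ) N                             ≡⟨ periodic-twoPeriods val-periodic pos₁ ⟨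
    sumTo (λ m → val σ (pos₁ + m)) (N + N)          ≡⟨ cong (sumTo (λ m → val σ (pos₁ + m))) (trans (sym Kk+1≡2N) (+-comm (K * k) 1)) ⟩
    val σ (pos₁ + 0) + sumTo (λ m → val σ (pos₁ + suc m)) (K * k)
                                                    ≡⟨ cong₂ _+_ (trans (cong (val σ) (+-identityʳ pos₁)) val-pos₁)
                                                                 (sumTo-cong (K * k) (λ m → cong (val σ) (+-suc pos₁ m))) ⟩
    1 + sumTo (λ m → val σ (suc pos₁ + m)) (K * k)  ≤⟨ +-monoʳ-≤ 1 (sumTo-blocks k _ _ K block≤max) ⟩
    1 + K * maxWindowSum σ k                        ∎
    where
    open ≤-Reasoning
    block≤max : ∀ t → sumTo (λ j → val σ (suc pos₁ + (t * k + j))) k ≤ maxWindowSum σ k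
    block≤max t = ≤-trans (≤-reflexive (sumTo-cong k (λ j → cong (val σ) (sym (+-assoc (suc pos₁) (t * k) j)))))
                          (window≤max k (suc pos₁ + t * k))

-- From Kk + 1 = 2n, n ≥ 2K + 2 and n(n+1) ≤ 1 + K·M it follows that
-- 2M ≥ k(n+1) + 3: indeed K(k(n+1) + 2) + (n+1) = 2n(n+1) + 2K ≤ 2 + 2KM + 2K.
twiceMax-bound : ∀ K k n M → K * k + 1 ≡ n + n → 2 * K + 2 ≤ n → n * suc n ≤ 1 + K * M →
            3 + k * (n + 1) ≤ 2 * M
twiceMax-bound K k n M Kk+1≡2n 2K+2≤n counted =
  subst (_≤ 2 * M) (trans (sym (+-suc X 2)) (+-comm X 3)) (*-cancelˡ-< K (X + 2) (2 * M) K[X+2]<K[2M])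
  where
  X = k * (n + 1)
  expand : ∀ K k n → K * (k * (n + 1) + 2) + (n + 1) ≡ (K * k + 1) * (n + 1) + 2 * K
  expand = solve-∀
  regroup₁ : ∀ n → (n + n) * (n + 1) ≡ 2 * (n * suc n)
  regroup₁ = solve-∀
  regroup₂ : ∀ K M → 2 * (1 + K * M) + 2 * K ≡ (K * (2 * M) + 2 * K) + 2
  regroup₂ = solve-∀
  regroup₃ : ∀ K A → K * A + (2 * K + 3) ≡ (K * A + 1 + 2 * K) + 2
  regroup₃ = solve-∀
  bound : (K * (X + 2) + 1 + 2 * K) + 2 ≤ (K * (2 * M) + 2 * K) + 2
  bound = begin
    (K * (X + 2) + 1 + 2 * K) + 2    ≡⟨ regroup₃ K (X + 2) ⟨
    K * (X + 2) + (2 * K + 3)        ≤⟨ +-monoʳ-≤ (K * (X + 2)) (subst (_≤ n + 1) (+-assoc (2 * K) 2 1) (+-monoˡ-≤ 1 2K+2≤n)) ⟩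
    K * (X + 2) + (n + 1)            ≡⟨ expand K k n ⟩
    (K * k + 1) * (n + 1) + 2 * K    ≡⟨ cong (λ x → x * (n + 1) + 2 * K) Kk+1≡2n ⟩
    (n + n) * (n + 1) + 2 * K        ≡⟨ cong (_+ 2 * K) (regroup₁ n) ⟩
    2 * (n * suc n) + 2 * K          ≤⟨ +-monoˡ-≤ (2 * K) (*-monoʳ-≤ 2 counted) ⟩
    2 * (1 + K * M) + 2 * K          ≡⟨ regroup₂ K M ⟩
    (K * (2 * M) + 2 * K) + 2        ∎
    where open ≤-Reasoning
  K[X+2]<K[2M] : K * (X + 2) < K * (2 * M)
  K[X+2]<K[2M] = subst (_≤ K * (2 * M)) (+-comm (K * (X + 2)) 1)
    (+-cancelʳ-≤ (2 * K) _ _ (+-cancelʳ-≤ 2 _ _ bound))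

-- The hypotheses on k and n: writing k = 2h+1 and n = (h+1) + qk, the number
-- K = 2q+1 of windows satisfies Kk + 1 = 2n, and n > k forces q ≥ 1, whence
-- n ≥ 2K + 2 once h ≥ 2.
windowCount-hq : ∀ h q k n → k ≡ 1 + h * 2 → n ≡ suc h + q * k → 2 ≤ h → k < n →
                 (2 * q + 1) * k + 1 ≡ n + n × 2 * (2 * q + 1) + 2 ≤ n
windowCount-hq h zero k n refl refl _ k<n = ⊥-elim (<⇒≱ k<n n≤k)
  where
  split : ∀ h → 1 + h * 2 ≡ (suc h + 0) + h
  split = solve-∀
  n≤k : suc h + 0 ≤ 1 + h * 2
  n≤k = subst (suc h + 0 ≤_) (sym (split h)) (m≤m+n (suc h + 0) h)
windowCount-hq zero          (suc q′) k n _ _ () _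
windowCount-hq (suc zero)    (suc q′) k n _ _ (s≤s ()) _
windowCount-hq (suc (suc h′)) (suc q′) k n refl refl _ _ =
  double h q , subst (2 * (2 * q + 1) + 2 ≤_) (sym (split h′ q′)) (m≤m+n _ _)
  where
  h = suc (suc h′)
  q = suc q′
  double : ∀ h q → (2 * q + 1) * (1 + h * 2) + 1 ≡ (suc h + q * (1 + h * 2)) + (suc h + q * (1 + h * 2))
  double = solve-∀
  split : ∀ h′ q′ → 3 + h′ + suc q′ * (1 + (2 + h′) * 2) ≡ (2 * (2 * suc q′ + 1) + 2) + (h′ * 3 + q′ * (1 + h′ * 2))
  split = solve-∀

windowCount : ∀ k n .{{_ : NonZero k}} → k % 2 ≡ 1 → 5 ≤ k → k < n → n % k ≡ (k + 1) / 2 →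
              (2 * (n / k) + 1) * k + 1 ≡ n + n × 2 * (2 * (n / k) + 1) + 2 ≤ n
windowCount k n k-odd 5≤k k<n n≡half = windowCount-hq h (n / k) k n k≡2h+1 n≡h+1+qk 2≤h k<n
  where
  h = k / 2
  k≡2h+1 : k ≡ 1 + h * 2
  k≡2h+1 = trans (m≡m%n+[m/n]*n k 2) (cong (_+ h * 2) k-odd)
  halve : ∀ h → 1 + h * 2 + 1 ≡ suc h * 2
  halve = solve-∀
  half≡h+1 : (k + 1) / 2 ≡ suc h
  half≡h+1 = trans (cong (λ x → (x + 1) / 2) k≡2h+1) (trans (cong (_/ 2) (halve h)) (m*n/n≡m (suc h) 2))
  n≡h+1+qk : n ≡ suc h + (n / k) * k
  n≡h+1+qk = trans (m≡m%n+[m/n]*n n k) (cong (_+ (n / k) * k) (trans n≡half half≡h+1))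
  2≤h : 2 ≤ h
  2≤h = *-cancelʳ-≤ 2 h 2 (+-cancelˡ-≤ 1 _ _ (subst (5 ≤_) k≡2h+1 5≤k))

-- The rational inequality 1 < M − X/2 ⇔ 2M ≥ X + 3, checked on the
-- unnormalised representative (2M − X)/2 of M/1 − X/2.
one<halfExcessᵘ : ∀ M X → 3 + X ≤ 2 * M → ℚᵘ.1ℚᵘ ℚᵘ.< ℚᵘ.mkℚᵘ (ℤ.+ M) 0 ℚᵘ.- ℚᵘ.mkℚᵘ (ℤ.+ X) 1
one<halfExcessᵘ M X 3+X≤2M = ℚᵘ.*<* (subst (ℤ.+ 2 ℤ.<_) (sym numerator) (ℤ.+<+ (m+n≤o⇒m≤o∸n 3 3+X≤2M)))
  where
  open ≡-Reasoning
  collect : ∀ a b → (a ℤ.* ℤ.+ 2 ℤ.+ ℤ.- b ℤ.* ℤ.+ 1) ℤ.* ℤ.+ 1 ≡ a ℤ.* ℤ.+ 2 ℤ.- b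
  collect = ℤSolver.solve-∀
  numerator : (ℤ.+ M ℤ.* ℤ.+ 2 ℤ.+ ℤ.- (ℤ.+ X) ℤ.* ℤ.+ 1) ℤ.* ℤ.+ 1 ≡ ℤ.+ (2 * M ∸ X)
  numerator = begin
    (ℤ.+ M ℤ.* ℤ.+ 2 ℤ.+ ℤ.- (ℤ.+ X) ℤ.* ℤ.+ 1) ℤ.* ℤ.+ 1  ≡⟨ collect (ℤ.+ M) (ℤ.+ X) ⟩
    ℤ.+ M ℤ.* ℤ.+ 2 ℤ.- ℤ.+ X                              ≡⟨ cong (ℤ._- ℤ.+ X) (ℤP.pos-* M 2) ⟨
    ℤ.+ (M * 2) ℤ.- ℤ.+ X                                  ≡⟨ cong (λ m → ℤ.+ m ℤ.- ℤ.+ X) (*-comm M 2) ⟩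
    ℤ.+ (2 * M) ℤ.- ℤ.+ X                                  ≡⟨ ℤP.[+m]-[+n]≡m⊖n (2 * M) X ⟩
    (2 * M) ℤ.⊖ X                                          ≡⟨ ℤP.⊖-≥ (m+n≤o⇒n≤o 3 3+X≤2M) ⟩
    ℤ.+ (2 * M ∸ X)                                        ∎

one<halfExcess : ∀ M X → 3 + X ≤ 2 * M → 1ℚ <ℚ (ℤ.+ M) ℚ./ 1 ℚ.- (ℤ.+ X) ℚ./ 2
one<halfExcess M X 3+X≤2M =
  ℚP.toℚᵘ-cancel-< (ℚᵘP.<-respʳ-≃ (ℚᵘP.≃-sym representative) (one<halfExcessᵘ M X 3+X≤2M))
  where
  a = (ℤ.+ M) ℚ./ 1
  b = (ℤ.+ X) ℚ./ 2
  representative : toℚᵘ (a ℚ.- b) ℚᵘ.≃ ℚᵘ.mkℚᵘ (ℤ.+ M) 0 ℚᵘ.- ℚᵘ.mkℚᵘ (ℤ.+ X) 1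
  representative = ℚᵘP.≃-trans (ℚP.toℚᵘ-homo-+ a (ℚ.- b))
    (ℚᵘP.+-cong (ℚP.toℚᵘ-fromℚᵘ (ℚᵘ.mkℚᵘ (ℤ.+ M) 0))
      (ℚᵘP.≃-trans (ℚP.toℚᵘ-homo‿- b) (ℚᵘP.-‿cong (ℚP.toℚᵘ-fromℚᵘ (ℚᵘ.mkℚᵘ (ℤ.+ X) 1)))))

theorem1p3 : (k n : ℕ) → .{{_ : NonZero k}} → .{{_ : NonZero n}} → k % 2 ≡ 1 → 5 ≤ k → k < n →
    n % k ≡ (k + 1) / 2 → (σ : Permutation′ n) → 1ℚ <ℚ msumπ σ k
theorem1p3 k zero      _     _   ()  _      _
theorem1p3 k (suc n′) k-odd 5≤k k<n n≡half σ with windowCount k (suc n′) k-odd 5≤k k<n n≡half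
... | Kk+1≡2n , 2K+2≤n = one<halfExcess M (k * (n + 1)) (twiceMax-bound K k n M Kk+1≡2n 2K+2≤n counted)
  where
  n = suc n′
  K = 2 * (n / k) + 1
  M = maxWindowSum σ k
  counted : n * suc n ≤ 1 + K * M
  counted = CyclicSequence.counting n′ σ k K Kk+1≡2n
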